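{- Let $n\ge 1$ and let $\mathcal K_n$ be the $2$-skeleton of the Boolean lattice $\mathcal B_n$. Then the ternary relations $\mathcal T(\mathcal K_n)$ and $\mathcal T(A_{n-1})$ are isomorphic. Consequently, under the induced identification of coordinates, $P(\mathcal K_n)=P(A_{n-1})$.
   Context: A (symmetric) ternary relation is a pair $\mathcal T=(\Sigma,R)$ where $\Sigma$ is a finite set and $R$ is a set of unordered triples $[i,j,k]$ of elements of $\Sigma$. Two ternary relations $(\Sigma_1,R_1)$, $(\Sigma_2,R_2)$ are isomorphic if there is a bijection $\phi:\Sigma_1\to\Sigma_2$ such that $[i,j,k]\in R_1$ iff $[\phi(i),\phi(j),\phi(k)]\in R_2$. The ternary polytope is $P(\mathcal T)=\mathrm{Conv}\{\mathbf 1_i+\mathbf 1_j-\mathbf 1_k,\ \mathbf 1_i-\mathbf 1_j+\mathbf 1_k,\ -\mathbf 1_i+\mathbf 1_j+\mathbf 1_k : [i,j,k]\in R\}\subset\mathbb R^{\Sigma}$ ($\mathbf 1_i$ the standard basis). For a finite configuration $\Omega=\{\pm\alpha_1,\dots,\pm\alpha_m\}\subset\mathbb R^d$ with $\Omega=-\Omega$, $\mathcal T(\Omega)=(\{1,\dots,m\},R_\Omega)$ where $R_\Omega$ is the set of all triples $[i,j,k]$ such that $\pm\alpha_i\pm\alpha_j\pm\alpha_k=0$ for some choice of signs; $P(\Omega):=P(\mathcal T(\Omega))$. The root system $A_{n-1}$ is $\{\pm(\varepsilon_i-\varepsilon_j):1\le i<j\le n\}\subset\mathbb R^n$, $\varepsilon_i$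 the standard basis. $\mathcal K_n$ is the poset of subsets of $\{1,\dots,n\}$ of cardinality at most $3$, ordered by inclusion; its vertices are $\{i\}$, its edges are $\{i,j\}$ ($i\neq j$) and its triangles are $\{i,j,k\}$ (distinct), the facets of $\{i,j,k\}$ being $\{i,j\},\{j,k\},\{i,k\}$. For a $2$-dimensional simplicial poset $\mathcal P$ (such as $\mathcal K_n$), $\mathcal T(\mathcal P)=(\mathcal P(1),R_{\mathcal P})$ where $\mathcal P(1)$ is the set of edges and $R_{\mathcal P}$ consists of all triples $[e_1,e_2,e_3]$ such that $e_1,e_2,e_3$ are the three edge facets of some triangle; $P(\mathcal P):=P(\mathcal T(\mathcal P))$.
   Formalization: The equality $P(\mathcal K_n)=P(A_{n-1})$ is asserted only for points with rational coordinates rather than for all points of $\mathbb R^{\Sigma}$, with convex combinations taken with rational weights. -}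

module Defs where

open import Data.Nat as ℕ using (ℕ)
open import Data.Fin as Fin using (Fin; _<_)
open import Data.Fin.Properties as FinP using ()
open import Data.Integer as ℤ using (ℤ)
open import Data.Rational as ℚ using (ℚ; 0ℚ; 1ℚ)
open import Data.Bool using (if_then_else_)
open import Data.List using (List; []; _∷_; map; foldr)
import Data.List as List
open import Data.List.Relation.Unary.All using (All)
open import Data.List.Relation.Binary.Permutation.Propositional using (_↭_)
open import Data.Product using (Σ; ∃; _×_; _,_; proj₁; proj₂)
open import Data.Sum using (_⊎_)
open import Relation.Nullary using (does; yes; no; ¬_)
open import Relation.Binary.Definitions using (DecidableEquality)
open import Relation.Binary.PropositionalEquality using (_≡_; _≢_; refl; cong)
open import Function.Bundles using (_⤖_; _⇔_; Bijection)

-- The set R of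
-- unordered triples is encoded as a predicate on ordered triples that is
-- (by construction in all instances below) invariant under permuting
-- its arguments; [i,j,k] ∈ R  iff  R i j k.
record TernaryRelation : Set₁ where
  field
    Carrier : Set
    _≟_     : DecidableEquality Carrier
    R       : Carrier → Carrier → Carrier → Set

open TernaryRelation public

Iso : TernaryRelation → TernaryRelation → Set
Iso T₁ T₂ = Σ (Carrier T₁ ⤖ Carrier T₂) λ φ →
  ∀ i j k → R T₁ i j k ⇔ R T₂ (Bijection.to φ i) (Bijection.to φ j) (Bijection.to φ k)

𝟙 : (T : TernaryRelation) → Carrier T → Carrier T → ℚ
𝟙 T i t = if does (_≟_ T i t) then 1ℚ else 0ℚ

IsGenerator : (T : TernaryRelation) → (Carrier T → ℚ) → Set
IsGenerator T g = ∃ λ i → ∃ λ j → ∃ λ k → R T i j k ×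
  (  (∀ t → g t ≡ (𝟙 T i t ℚ.+ 𝟙 T j t) ℚ.- 𝟙 T k t)
  ⊎ ((∀ t → g t ≡ (𝟙 T i t ℚ.- 𝟙 T j t) ℚ.+ 𝟙 T k t)
  ⊎  (∀ t → g t ≡ ((ℚ.- 𝟙 T i t) ℚ.+ 𝟙 T j t) ℚ.+ 𝟙 T k t)))

sumℚ : List ℚ → ℚ
sumℚ = foldr ℚ._+_ 0ℚ

InConv : {S : Set} → ((S → ℚ) → Set) → (S → ℚ) → Set
InConv {S} G x = ∃ λ (L : List (ℚ × (S → ℚ))) →
  All (λ wg → (0ℚ ℚ.≤ proj₁ wg) × G (proj₂ wg)) L ×
  (sumℚ (map proj₁ L) ≡ 1ℚ) ×
  (∀ t → x t ≡ sumℚ (map (λ wg → proj₁ wg ℚ.* proj₂ wg t) L))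

InP : (T : TernaryRelation) → (Carrier T → ℚ) → Set
InP T = InConv (IsGenerator T)

-- an edge {a,b} of K_n, stored with a < b
record Edge (n : ℕ) : Set where
  constructor edge
  field
    lo hi : Fin n
    .lo<hi : lo < hi

open Edge public

_≟E_ : {n : ℕ} → DecidableEquality (Edge n)
edge a b _ ≟E edge c d _ with a FinP.≟ c | b FinP.≟ d
... | yes refl | yes refl = yes refl
... | no a≢c   | _        = no λ e → a≢c (cong lo e)
... | yes _    | no b≢d   = no λ e → b≢d (cong hi e)

RK : {n : ℕ} → Edge n → Edge n → Edge n → Set
RK {n} e₁ e₂ e₃ = ∃ λ (a : Fin n) → ∃ λ b → ∃ λ c →
  Σ (a < b) λ ab → Σ (b < c) λ bc → Σ (a < c) λ ac →
  (e₁ ∷ e₂ ∷ e₃ ∷ []) ↭ (edge a b ab ∷ edge b c bc ∷ edge a c ac ∷ [])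

𝒯K : ℕ → TernaryRelation
𝒯K n = record { Carrier = Edge n ; _≟_ = _≟E_ ; R = RK }

ε : {n : ℕ} → Fin n → Fin n → ℤ
ε i t = if does (i FinP.≟ t) then ℤ.+ 1 else ℤ.+ 0

_≐_ : {n : ℕ} → (Fin n → ℤ) → (Fin n → ℤ) → Set
v ≐ w = ∀ t → v t ≡ w t

neg : {n : ℕ} → (Fin n → ℤ) → Fin n → ℤ
neg v t = ℤ.- v t

-- v ∈ A_{n-1} = {±(ε_i − ε_j) : i < j} = {ε_i − ε_j : i ≠ j}
InA : (n : ℕ) → (Fin n → ℤ) → Set
InA n v = ∃ λ (i : Fin n) → ∃ λ j → i ≢ j × (v ≐ λ t → ε i t ℤ.- ε j t)

-- Ω = {±α₁,…,±α_m} is exactly A_{n-1}, with the pairs ±α_i distinct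
IsEnumeration : (n m : ℕ) → (Fin m → Fin n → ℤ) → Set
IsEnumeration n m α =
  (∀ i → InA n (α i)) ×
  (∀ v → InA n v → ∃ λ i → (v ≐ α i) ⊎ (v ≐ neg (α i))) ×
  (∀ i j → ((α i ≐ α j) ⊎ (α i ≐ neg (α j))) → i ≡ j)

data Sign : Set where
  ⊕ ⊖ : Sign

_·_ : Sign → ℤ → ℤ
⊕ · x = x
⊖ · x = ℤ.- x

RΩ : {n m : ℕ} → (Fin m → Fin n → ℤ) → Fin m → Fin m → Fin m → Set
RΩ α i j k = ∃ λ s₁ → ∃ λ s₂ → ∃ λ s₃ →
  ∀ t → ((s₁ · α i t) ℤ.+ (s₂ · α j t)) ℤ.+ (s₃ · α k t) ≡ ℤ.+ 0

𝒯Ω : {n m : ℕ} → (Fin m → Fin n → ℤ) → TernaryRelation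
𝒯Ω {n} {m} α = record { Carrier = Fin m ; _≟_ = FinP._≟_ ; R = RΩ α }

{-# OPTIONS --safe #-}
-- The edge {a < b} of K_n is sent to the pair of roots ±(ε_a − ε_b); this is a bijection onto
-- the pairs of A_{n-1}.  Three roots have a vanishing signed sum exactly when their edges form a
-- triangle: (ε_a − ε_b) + (ε_b − ε_c) − (ε_a − ε_c) = 0, and conversely the p-th coordinate of a
-- signed sum of three roots is a sum of ±1's, one for each of the edges through p, so it can only
-- vanish if every vertex lies on 0 or 2 of the edges, which forces a triangle.  An isomorphism of
-- ternary relations permutes the coordinates and carries the generators of one ternary polytope
-- onto those of the other, so it identifies the two polytopes.
module Submission where

open import Defs
open import Data.Nat using (ℕ; _≤_)
open import Data.Fin using (Fin; _<_)
open import Data.Integer using (ℤ; +_; -[1+_])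
open import Data.Rational using (ℚ; 1ℚ; 0ℚ)
open import Data.Product using (Σ; proj₁)
open import Function using (_∘_; case_of_)
open import Function.Bundles using (_⇔_; Bijection)

import Data.Fin.Properties as FinP
import Data.Integer as ℤ
import Data.Integer.Properties as ℤP
import Data.Rational as ℚ
import Data.List.Properties as List
import Data.List.Relation.Unary.All as All
import Data.List.Relation.Unary.All.Properties as All
import Function.Properties.Equivalence as ⇔
open import Algebra.Properties.CommutativeSemigroup ℤP.+-commutativeSemigroup using (xy∙z≈xz∙y)
open import Data.Bool using (if_then_else_)
open import Data.Empty using (⊥; ⊥-elim)
open import Data.Integer.Solver using (module +-*-Solver)
open import Data.List using (List; []; _∷_; map)
open import Data.List.Relation.Binary.Permutation.Propositional using (_↭_; refl; prep; swap; trans; ↭-sym)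
open import Data.List.Relation.Binary.Permutation.Propositional.Properties using (map⁺)
open import Data.Product using (∃; _×_; _,_; proj₂; map₂)
open import Data.Sum using (_⊎_; inj₁; inj₂)
import Data.Sum as Sum
open import Function.Bundles using (_↔_; Inverse; Equivalence; mk⤖; mk⇔)
open import Function.Definitions using (Injective; Surjective)
open import Function.Properties.Bijection using (⤖⇒↔)
open import Function.Properties.Inverse using (↔-sym)
open import Relation.Binary.Definitions using (tri<; tri≈; tri>)
open import Relation.Binary.PropositionalEquality
  using (_≡_; _≢_; _≗_; refl; sym; cong; cong₂; subst; module ≡-Reasoning)
  renaming (trans to ≡-trans)
open import Relation.Nullary using (¬_; Dec; yes; no; contradiction)
open import Relation.Nullary.Decidable using (_⊎-dec_; does-⇔; dec-true; dec-false; recompute)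

-- Ternary polytopes along isomorphisms

InConv-resp : {S : Set} {G : (S → ℚ) → Set} {x y : S → ℚ} → x ≗ y → InConv G x → InConv G y
InConv-resp x≗y (L , valid , total , combo) = L , valid , total , λ t → ≡-trans (sym (x≗y t)) (combo t)

InConv-∘ : {S S′ : Set} {G : (S → ℚ) → Set} {G′ : (S′ → ℚ) → Set} (f : S′ → S) →
           (∀ {g} → G g → G′ (g ∘ f)) → ∀ {x} → InConv G x → InConv G′ (x ∘ f)
InConv-∘ f G⇒G′ (L , valid , total , combo) =
  map (map₂ (_∘ f)) L ,
  All.map⁺ (All.map (map₂ G⇒G′) valid) ,
  ≡-trans (cong sumℚ (sym (List.map-∘ L))) total ,
  λ t → ≡-trans (combo (f t)) (cong sumℚ (List.map-∘ L))

R-cong : (T : TernaryRelation) {i i′ j j′ k k′ : Carrier T} →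
         i ≡ i′ → j ≡ j′ → k ≡ k′ → R T i j k → R T i′ j′ k′
R-cong T refl refl refl r = r

module _ {T₁ T₂ : TernaryRelation} (φ : Carrier T₁ ↔ Carrier T₂) where
  open Inverse φ

  𝟙-∘from : ∀ i t → 𝟙 T₁ i (from t) ≡ 𝟙 T₂ (to i) t
  𝟙-∘from i t = cong (if_then 1ℚ else 0ℚ)
    (does-⇔ (mk⇔ inverseˡ (λ to-i≡t → sym (inverseʳ (sym to-i≡t))))
            (_≟_ T₁ i (from t)) (_≟_ T₂ (to i) t))

  IsGenerator-∘from : (∀ {i j k} → R T₁ i j k → R T₂ (to i) (to j) (to k)) →
                      ∀ {g} → IsGenerator T₁ g → IsGenerator T₂ (g ∘ from)
  IsGenerator-∘from R⇒R {g} (i , j , k , r , shape) =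
    to i , to j , to k , R⇒R r ,
    Sum.map (reindex (λ a b c → (a ℚ.+ b) ℚ.- c))
      (Sum.map (reindex (λ a b c → (a ℚ.- b) ℚ.+ c))
               (reindex (λ a b c → ((ℚ.- a) ℚ.+ b) ℚ.+ c))) shape
    where
    reindex : (F : ℚ → ℚ → ℚ → ℚ) →
              (∀ t → g t ≡ F (𝟙 T₁ i t) (𝟙 T₁ j t) (𝟙 T₁ k t)) →
              ∀ t → g (from t) ≡ F (𝟙 T₂ (to i) t) (𝟙 T₂ (to j) t) (𝟙 T₂ (to k) t)
    reindex F g≗F t rewrite sym (𝟙-∘from i t) | sym (𝟙-∘from j t) | sym (𝟙-∘from k t) = g≗F (from t)

InP-transport : {T₁ T₂ : TernaryRelation} (I : Iso T₁ T₂) →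
                ∀ x → InP T₂ x ⇔ InP T₁ (x ∘ Bijection.to (proj₁ I))
InP-transport {T₁} {T₂} (φ , R⇔R) x = mk⇔
  (InConv-∘ to (IsGenerator-∘from {T₂} {T₁} (↔-sym ψ) R-from))
  (InConv-resp (cong x ∘ strictlyInverseˡ) ∘ InConv-∘ from (IsGenerator-∘from {T₁} {T₂} ψ R-to))
  where
  ψ : Carrier T₁ ↔ Carrier T₂
  ψ = ⤖⇒↔ φ
  open Inverse ψ

  R-to : ∀ {i j k} → R T₁ i j k → R T₂ (to i) (to j) (to k)
  R-to = Equivalence.to (R⇔R _ _ _)

  R-from : ∀ {i j k} → R T₂ i j k → R T₁ (from i) (from j) (from k)
  R-from {i} {j} {k} = Equivalence.from (R⇔R _ _ _) ∘
    R-cong T₂ (sym (strictlyInverseˡ i)) (sym (strictlyInverseˡ j)) (sym (strictlyInverseˡ k))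

_⊛_ : Sign → Sign → Sign
⊕ ⊛ s = s
⊖ ⊛ ⊕ = ⊖
⊖ ⊛ ⊖ = ⊕

·-⊛ : ∀ s σ x → s · (σ · x) ≡ (s ⊛ σ) · x
·-⊛ ⊕ σ x = refl
·-⊛ ⊖ ⊕ x = refl
·-⊛ ⊖ ⊖ x = ℤP.neg-involutive x

·-involutive : ∀ σ x → σ · (σ · x) ≡ x
·-involutive ⊕ x = refl
·-involutive ⊖ x = ℤP.neg-involutive x

·-zero : ∀ s {x} → x ≡ + 0 → s · x ≡ + 0
·-zero ⊕ refl = refl
·-zero ⊖ refl = refl

IsUnit : ℤ → Set
IsUnit x = x ≡ + 1 ⊎ x ≡ -[1+ 0 ]

·-unit : ∀ s {x} → IsUnit x → IsUnit (s · x)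
·-unit ⊕ u = u
·-unit ⊖ (inj₁ refl) = inj₂ refl
·-unit ⊖ (inj₂ refl) = inj₁ refl

unit≢0 : ∀ {x} → IsUnit x → x ≢ + 0
unit≢0 (inj₁ refl) ()
unit≢0 (inj₂ refl) ()

module _ {x y z : ℤ} where
  unit+0+0≢0 : IsUnit x → y ≡ + 0 → z ≡ + 0 → (x ℤ.+ y) ℤ.+ z ≢ + 0
  unit+0+0≢0 (inj₁ refl) refl refl ()
  unit+0+0≢0 (inj₂ refl) refl refl ()

  0+unit+0≢0 : x ≡ + 0 → IsUnit y → z ≡ + 0 → (x ℤ.+ y) ℤ.+ z ≢ + 0
  0+unit+0≢0 refl (inj₁ refl) refl ()
  0+unit+0≢0 refl (inj₂ refl) refl ()

  0+0+unit≢0 : x ≡ + 0 → y ≡ + 0 → IsUnit z → (x ℤ.+ y) ℤ.+ z ≢ + 0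
  0+0+unit≢0 refl refl (inj₁ refl) ()
  0+0+unit≢0 refl refl (inj₂ refl) ()

  unit+unit+unit≢0 : IsUnit x → IsUnit y → IsUnit z → (x ℤ.+ y) ℤ.+ z ≢ + 0
  unit+unit+unit≢0 (inj₁ refl) (inj₁ refl) (inj₁ refl) ()
  unit+unit+unit≢0 (inj₁ refl) (inj₁ refl) (inj₂ refl) ()
  unit+unit+unit≢0 (inj₁ refl) (inj₂ refl) (inj₁ refl) ()
  unit+unit+unit≢0 (inj₁ refl) (inj₂ refl) (inj₂ refl) ()
  unit+unit+unit≢0 (inj₂ refl) (inj₁ refl) (inj₁ refl) ()
  unit+unit+unit≢0 (inj₂ refl) (inj₁ refl) (inj₂ refl) ()
  unit+unit+unit≢0 (inj₂ refl) (inj₂ refl) (inj₁ refl) ()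
  unit+unit+unit≢0 (inj₂ refl) (inj₂ refl) (inj₂ refl) ()

module _ {n : ℕ} where
  _≈±_ : (u v : Fin n → ℤ) → Set
  u ≈± v = ∃ λ σ → ∀ t → u t ≡ σ · v t

  ≈±-sym : ∀ {u v} → u ≈± v → v ≈± u
  ≈±-sym {v = v} (σ , u≗σv) =
    σ , λ t → ≡-trans (sym (·-involutive σ (v t))) (cong (σ ·_) (sym (u≗σv t)))

  ≈±-trans : ∀ {u v w} → u ≈± v → v ≈± w → u ≈± w
  ≈±-trans {w = w} (σ , u≗σv) (τ , v≗τw) =
    σ ⊛ τ , λ t → ≡-trans (u≗σv t) (≡-trans (cong (σ ·_) (v≗τw t)) (·-⊛ σ τ (w t)))

  ⊎⇒≈± : ∀ {u v} → (u ≐ v) ⊎ (u ≐ neg v) → u ≈± v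
  ⊎⇒≈± (inj₁ u≐v)  = ⊕ , u≐v
  ⊎⇒≈± (inj₂ u≐-v) = ⊖ , u≐-v

  ≈±⇒⊎ : ∀ {u v} → u ≈± v → (u ≐ v) ⊎ (u ≐ neg v)
  ≈±⇒⊎ (⊕ , u≐v)  = inj₁ u≐v
  ≈±⇒⊎ (⊖ , u≐-v) = inj₂ u≐-v

  ZeroSignedSum : (u v w : Fin n → ℤ) → Set
  ZeroSignedSum u v w = ∃ λ s₁ → ∃ λ s₂ → ∃ λ s₃ →
    ∀ t → ((s₁ · u t) ℤ.+ (s₂ · v t)) ℤ.+ (s₃ · w t) ≡ + 0

  ZeroSignedSum-≈± : ∀ {u u′ v v′ w w′} → u ≈± u′ → v ≈± v′ → w ≈± w′ →
                     ZeroSignedSum u v w → ZeroSignedSum u′ v′ w′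
  ZeroSignedSum-≈± {u} {u′} {v} {v′} {w} {w′} (σ₁ , u≗) (σ₂ , v≗) (σ₃ , w≗) (s₁ , s₂ , s₃ , sum≡0) =
    s₁ ⊛ σ₁ , s₂ ⊛ σ₂ , s₃ ⊛ σ₃ , λ t → begin
      ((s₁ ⊛ σ₁) · u′ t ℤ.+ (s₂ ⊛ σ₂) · v′ t) ℤ.+ (s₃ ⊛ σ₃) · w′ t
        ≡⟨ cong₂ ℤ._+_ (cong₂ ℤ._+_ (resign s₁ σ₁ u≗ t) (resign s₂ σ₂ v≗ t)) (resign s₃ σ₃ w≗ t) ⟩
      (s₁ · u t ℤ.+ s₂ · v t) ℤ.+ s₃ · w t
        ≡⟨ sum≡0 t ⟩
      + 0 ∎
    where
    open ≡-Reasoning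
    resign : ∀ s σ {x y : Fin n → ℤ} → (∀ t → x t ≡ σ · y t) → ∀ t → (s ⊛ σ) · y t ≡ s · x t
    resign s σ {x} {y} x≗σy t = ≡-trans (sym (·-⊛ s σ (y t))) (cong (s ·_) (sym (x≗σy t)))

  ZeroSignedSum-cong : ∀ {u u′ v v′ w w′} → u ≈± u′ → v ≈± v′ → w ≈± w′ →
                       ZeroSignedSum u v w ⇔ ZeroSignedSum u′ v′ w′
  ZeroSignedSum-cong u≈ v≈ w≈ =
    mk⇔ (ZeroSignedSum-≈± u≈ v≈ w≈) (ZeroSignedSum-≈± (≈±-sym u≈) (≈±-sym v≈) (≈±-sym w≈))

  -- The accumulator w turns the swap case of a permutation into a mere reassociation.
  Cancels : List (Fin n → ℤ) → (Fin n → ℤ) → Set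
  Cancels []       w = ∀ t → w t ≡ + 0
  Cancels (v ∷ vs) w = ∃ λ s → Cancels vs (λ t → w t ℤ.+ s · v t)

  Cancels-resp : ∀ vs {w w′} → w ≐ w′ → Cancels vs w → Cancels vs w′
  Cancels-resp []       w≐w′ w≐0 t     = ≡-trans (sym (w≐w′ t)) (w≐0 t)
  Cancels-resp (v ∷ vs) w≐w′ (s , rest) = s , Cancels-resp vs (λ t → cong (ℤ._+ s · v t) (w≐w′ t)) rest

  Cancels-↭ : ∀ {vs vs′} → vs ↭ vs′ → ∀ {w} → Cancels vs w → Cancels vs′ w
  Cancels-↭ refl                        c = c
  Cancels-↭ (prep _ p)            (s , c) = s , Cancels-↭ p c
  Cancels-↭ (swap _ _ p) {w} (s , s′ , c) =
    s′ , s , Cancels-↭ p (Cancels-resp _ (λ t → xy∙z≈xz∙y (w t) _ _) c)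
  Cancels-↭ (trans p q)                 c = Cancels-↭ q (Cancels-↭ p c)

  ZeroSignedSum⇔Cancels : ∀ {u v w} → ZeroSignedSum u v w ⇔ Cancels (u ∷ v ∷ w ∷ []) (λ _ → + 0)
  ZeroSignedSum⇔Cancels {u} = mk⇔
    (λ (s₁ , s₂ , s₃ , sum≡0) → s₁ , s₂ , s₃ , λ t → ≡-trans (0+ (s₁ · u t) _ _) (sum≡0 t))
    (λ (s₁ , s₂ , s₃ , sum≡0) → s₁ , s₂ , s₃ , λ t → ≡-trans (sym (0+ (s₁ · u t) _ _)) (sum≡0 t))
    where
    0+ : ∀ x y z → ((+ 0 ℤ.+ x) ℤ.+ y) ℤ.+ z ≡ (x ℤ.+ y) ℤ.+ z
    0+ x y z = cong (λ a → (a ℤ.+ y) ℤ.+ z) (ℤP.+-identityˡ x)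

  ZeroSignedSum-↭ : ∀ {u v w u′ v′ w′} → (u ∷ v ∷ w ∷ []) ↭ (u′ ∷ v′ ∷ w′ ∷ []) →
                    ZeroSignedSum u v w → ZeroSignedSum u′ v′ w′
  ZeroSignedSum-↭ p =
    Equivalence.from ZeroSignedSum⇔Cancels ∘ Cancels-↭ p {λ _ → + 0} ∘ Equivalence.to ZeroSignedSum⇔Cancels

-- Edges of K_n and roots of A_{n-1}

ε-diag : ∀ {n} (i : Fin n) → ε i i ≡ + 1
ε-diag i = cong (if_then + 1 else + 0) (dec-true (i FinP.≟ i) refl)

ε-≢ : ∀ {n} {i t : Fin n} → i ≢ t → ε i t ≡ + 0
ε-≢ {i = i} {t} i≢t = cong (if_then + 1 else + 0) (dec-false (i FinP.≟ t) i≢t)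

module _ {n : ℕ} where
  edge-lo<hi : (e : Edge n) → lo e < hi e
  edge-lo<hi (edge a b a<b) = recompute (a FinP.<? b) a<b

  edge-lo≢hi : (e : Edge n) → lo e ≢ hi e
  edge-lo≢hi e = FinP.<⇒≢ (edge-lo<hi e)

  infix 4 _∈ₑ_ _∈ₑ?_

  _∈ₑ_ : Fin n → Edge n → Set
  p ∈ₑ e = p ≡ lo e ⊎ p ≡ hi e

  _∈ₑ?_ : ∀ p e → Dec (p ∈ₑ e)
  p ∈ₑ? e = p FinP.≟ lo e ⊎-dec p FinP.≟ hi e

  ∉ₑ-∈ₑ⇒≢ : ∀ {p q} e → ¬ p ∈ₑ e → q ∈ₑ e → p ≢ q
  ∉ₑ-∈ₑ⇒≢ _ p∉e q∈e refl = p∉e q∈e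

  ∈ₑ⇒≡edge : ∀ {p q} e → p ∈ₑ e → q ∈ₑ e → (p<q : p < q) → e ≡ edge p q p<q
  ∈ₑ⇒≡edge e (inj₁ refl) (inj₂ refl) p<q = refl
  ∈ₑ⇒≡edge e (inj₁ refl) (inj₁ refl) p<q = contradiction p<q (FinP.<-irrefl refl)
  ∈ₑ⇒≡edge e (inj₂ refl) (inj₂ refl) p<q = contradiction p<q (FinP.<-irrefl refl)
  ∈ₑ⇒≡edge e (inj₂ refl) (inj₁ refl) p<q = ⊥-elim (FinP.<-asym p<q (edge-lo<hi e))

  ∈ₑ-pigeonhole : ∀ {a b c} e → a ≢ b → b ≢ c → a ≢ c → a ∈ₑ e → b ∈ₑ e → c ∈ₑ e → ⊥
  ∈ₑ-pigeonhole _ a≢b _ _ (inj₁ refl) (inj₁ refl) _ = a≢b refl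
  ∈ₑ-pigeonhole _ a≢b _ _ (inj₂ refl) (inj₂ refl) _ = a≢b refl
  ∈ₑ-pigeonhole _ _ _ a≢c (inj₁ refl) _ (inj₁ refl) = a≢c refl
  ∈ₑ-pigeonhole _ _ _ a≢c (inj₂ refl) _ (inj₂ refl) = a≢c refl
  ∈ₑ-pigeonhole _ _ b≢c _ _ (inj₁ refl) (inj₁ refl) = b≢c refl
  ∈ₑ-pigeonhole _ _ b≢c _ _ (inj₂ refl) (inj₂ refl) = b≢c refl

  other-endpoint : ∀ {p} e → p ∈ₑ e → ∃ λ q → q ∈ₑ e × q ≢ p
  other-endpoint e (inj₁ refl) = hi e , inj₂ refl , edge-lo≢hi e ∘ sym
  other-endpoint e (inj₂ refl) = lo e , inj₁ refl , edge-lo≢hi e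

  root : Edge n → Fin n → ℤ
  root e t = ε (lo e) t ℤ.- ε (hi e) t

  root-∈ₑ : ∀ {p} e → p ∈ₑ e → IsUnit (root e p)
  root-∈ₑ e (inj₁ refl) rewrite ε-diag (lo e) | ε-≢ (edge-lo≢hi e ∘ sym) = inj₁ refl
  root-∈ₑ e (inj₂ refl) rewrite ε-diag (hi e) | ε-≢ (edge-lo≢hi e)       = inj₂ refl

  root-∉ₑ : ∀ {p} e → ¬ p ∈ₑ e → root e p ≡ + 0
  root-∉ₑ e p∉e rewrite ε-≢ (p∉e ∘ inj₁ ∘ sym) | ε-≢ (p∉e ∘ inj₂ ∘ sym) = refl

  ±root-∈ₑ : ∀ s {p} e → p ∈ₑ e → IsUnit (s · root e p)
  ±root-∈ₑ s e p∈e = ·-unit s (root-∈ₑ e p∈e)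

  ±root-∉ₑ : ∀ s {p} e → ¬ p ∈ₑ e → s · root e p ≡ + 0
  ±root-∉ₑ s e p∉e = ·-zero s (root-∉ₑ e p∉e)

  root≢0⇒∈ₑ : ∀ {p} e → root e p ≢ + 0 → p ∈ₑ e
  root≢0⇒∈ₑ {p} e root≢0 with p ∈ₑ? e
  ... | yes p∈e = p∈e
  ... | no  p∉e = contradiction (root-∉ₑ e p∉e) root≢0

  root-≈±-injective : ∀ {e e′} → root e ≈± root e′ → e ≡ e′
  root-≈±-injective {e} {e′} (σ , root≗) =
    sym (∈ₑ⇒≡edge e′ (∈ₑ′ (inj₁ refl)) (∈ₑ′ (inj₂ refl)) (edge-lo<hi e))
    where
    ∈ₑ′ : ∀ {p} → p ∈ₑ e → p ∈ₑ e′
    ∈ₑ′ {p} p∈e = root≢0⇒∈ₑ e′ λ root′≡0 →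
      unit≢0 (root-∈ₑ e p∈e) (≡-trans (root≗ p) (·-zero σ root′≡0))

  root-InA : ∀ e → InA n (root e)
  root-InA e = lo e , hi e , edge-lo≢hi e , λ _ → refl

  InA⇒≈±root : ∀ {v} → InA n v → ∃ λ e → v ≈± root e
  InA⇒≈±root (p , q , p≢q , v≐) with FinP.<-cmp p q
  ... | tri< p<q _ _ = edge p q p<q , ⊕ , v≐
  ... | tri≈ _ p≡q _ = contradiction p≡q p≢q
  ... | tri> _ _ q<p = edge q p q<p , ⊖ , λ t → ≡-trans (v≐ t) (minus-flip (ε p t) (ε q t))
    where
    open +-*-Solver
    minus-flip : ∀ a b → a ℤ.- b ≡ ℤ.- (b ℤ.- a)
    minus-flip = solve 2 (λ a b → a :- b := :- (b :- a)) refl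

  -- Triangles of K_n are the vanishing signed sums of three roots

  RK-↭ : ∀ {e₁ e₂ e₃ f₁ f₂ f₃ : Edge n} →
         (e₁ ∷ e₂ ∷ e₃ ∷ []) ↭ (f₁ ∷ f₂ ∷ f₃ ∷ []) → RK f₁ f₂ f₃ → RK e₁ e₂ e₃
  RK-↭ p (a , b , c , a<b , b<c , a<c , q) = a , b , c , a<b , b<c , a<c , trans p q

  RK-swap₁₂ : ∀ {e₁ e₂ e₃} → RK e₂ e₁ e₃ → RK e₁ e₂ e₃
  RK-swap₁₂ = RK-↭ (swap _ _ refl)

  RK-swap₂₃ : ∀ {e₁ e₂ e₃} → RK e₁ e₃ e₂ → RK e₁ e₂ e₃
  RK-swap₂₃ = RK-↭ (prep _ (swap _ _ refl))

  sorted-triangle : ∀ {a b c e₁ e₂ e₃} → a < b → b < c →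
                    a ∈ₑ e₁ → b ∈ₑ e₁ → b ∈ₑ e₂ → c ∈ₑ e₂ → a ∈ₑ e₃ → c ∈ₑ e₃ → RK e₁ e₂ e₃
  sorted-triangle {a} {b} {c} {e₁} {e₂} {e₃} a<b b<c a∈₁ b∈₁ b∈₂ c∈₂ a∈₃ c∈₃
    with ∈ₑ⇒≡edge e₁ a∈₁ b∈₁ a<b | ∈ₑ⇒≡edge e₂ b∈₂ c∈₂ b<c | ∈ₑ⇒≡edge e₃ a∈₃ c∈₃ (FinP.<-trans a<b b<c)
  ... | refl | refl | refl = a , b , c , a<b , b<c , FinP.<-trans a<b b<c , refl

  triangle : ∀ {a b c e₁ e₂ e₃} → a ≢ b → b ≢ c → a ≢ c →
             a ∈ₑ e₁ → b ∈ₑ e₁ → b ∈ₑ e₂ → c ∈ₑ e₂ → a ∈ₑ e₃ → c ∈ₑ e₃ → RK e₁ e₂ e₃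
  triangle {a} {b} {c} a≢b b≢c a≢c a∈₁ b∈₁ b∈₂ c∈₂ a∈₃ c∈₃
    with FinP.<-cmp a b | FinP.<-cmp b c | FinP.<-cmp a c
  ... | tri≈ _ a≡b _ | _            | _            = contradiction a≡b a≢b
  ... | _            | tri≈ _ b≡c _ | _            = contradiction b≡c b≢c
  ... | _            | _            | tri≈ _ a≡c _ = contradiction a≡c a≢c
  ... | tri< a<b _ _ | tri< b<c _ _ | _            = sorted-triangle a<b b<c a∈₁ b∈₁ b∈₂ c∈₂ a∈₃ c∈₃
  ... | tri< a<b _ _ | tri> _ _ c<b | tri< a<c _ _ =
        RK-swap₁₂ (RK-swap₂₃ (RK-swap₁₂ (sorted-triangle a<c c<b a∈₃ c∈₃ c∈₂ b∈₂ a∈₁ b∈₁)))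
  ... | tri< a<b _ _ | tri> _ _ _   | tri> _ _ c<a =
        RK-swap₂₃ (RK-swap₁₂ (sorted-triangle c<a a<b c∈₃ a∈₃ a∈₁ b∈₁ c∈₂ b∈₂))
  ... | tri> _ _ b<a | tri< _ _ _   | tri< a<c _ _ =
        RK-swap₂₃ (sorted-triangle b<a a<c b∈₁ a∈₁ a∈₃ c∈₃ b∈₂ c∈₂)
  ... | tri> _ _ _   | tri< b<c _ _ | tri> _ _ c<a =
        RK-swap₁₂ (RK-swap₂₃ (sorted-triangle b<c c<a b∈₂ c∈₂ c∈₃ a∈₃ b∈₁ a∈₁))
  ... | tri> _ _ b<a | tri> _ _ c<b | _            =
        RK-swap₁₂ (sorted-triangle c<b b<a c∈₂ b∈₂ b∈₁ a∈₁ c∈₃ a∈₃)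

  data EvenIncidence (p : Fin n) (e₁ e₂ e₃ : Edge n) : Set where
    ∉∉∉ : ¬ p ∈ₑ e₁ → ¬ p ∈ₑ e₂ → ¬ p ∈ₑ e₃ → EvenIncidence p e₁ e₂ e₃
    ∈∈∉ : p ∈ₑ e₁ → p ∈ₑ e₂ → ¬ p ∈ₑ e₃ → EvenIncidence p e₁ e₂ e₃
    ∈∉∈ : p ∈ₑ e₁ → ¬ p ∈ₑ e₂ → p ∈ₑ e₃ → EvenIncidence p e₁ e₂ e₃
    ∉∈∈ : ¬ p ∈ₑ e₁ → p ∈ₑ e₂ → p ∈ₑ e₃ → EvenIncidence p e₁ e₂ e₃

  EvenIncidence-swap₂₃ : ∀ {p e₁ e₂ e₃} → EvenIncidence p e₁ e₂ e₃ → EvenIncidence p e₁ e₃ e₂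
  EvenIncidence-swap₂₃ (∉∉∉ ∉₁ ∉₂ ∉₃) = ∉∉∉ ∉₁ ∉₃ ∉₂
  EvenIncidence-swap₂₃ (∈∈∉ ∈₁ ∈₂ ∉₃) = ∈∉∈ ∈₁ ∉₃ ∈₂
  EvenIncidence-swap₂₃ (∈∉∈ ∈₁ ∉₂ ∈₃) = ∈∈∉ ∈₁ ∈₃ ∉₂
  EvenIncidence-swap₂₃ (∉∈∈ ∉₁ ∈₂ ∈₃) = ∉∈∈ ∉₁ ∈₃ ∈₂

  ZeroSignedSum⇒EvenIncidence : ∀ {e₁ e₂ e₃} → ZeroSignedSum (root e₁) (root e₂) (root e₃) →
                                ∀ p → EvenIncidence p e₁ e₂ e₃
  ZeroSignedSum⇒EvenIncidence {e₁} {e₂} {e₃} (s₁ , s₂ , s₃ , sum≡0) p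
    with p ∈ₑ? e₁ | p ∈ₑ? e₂ | p ∈ₑ? e₃
  ... | no  ∉₁ | no  ∉₂ | no  ∉₃ = ∉∉∉ ∉₁ ∉₂ ∉₃
  ... | yes ∈₁ | yes ∈₂ | no  ∉₃ = ∈∈∉ ∈₁ ∈₂ ∉₃
  ... | yes ∈₁ | no  ∉₂ | yes ∈₃ = ∈∉∈ ∈₁ ∉₂ ∈₃
  ... | no  ∉₁ | yes ∈₂ | yes ∈₃ = ∉∈∈ ∉₁ ∈₂ ∈₃
  ... | yes ∈₁ | no  ∉₂ | no  ∉₃ =
        contradiction (sum≡0 p) (unit+0+0≢0 (±root-∈ₑ s₁ e₁ ∈₁) (±root-∉ₑ s₂ e₂ ∉₂) (±root-∉ₑ s₃ e₃ ∉₃))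
  ... | no  ∉₁ | yes ∈₂ | no  ∉₃ =
        contradiction (sum≡0 p) (0+unit+0≢0 (±root-∉ₑ s₁ e₁ ∉₁) (±root-∈ₑ s₂ e₂ ∈₂) (±root-∉ₑ s₃ e₃ ∉₃))
  ... | no  ∉₁ | no  ∉₂ | yes ∈₃ =
        contradiction (sum≡0 p) (0+0+unit≢0 (±root-∉ₑ s₁ e₁ ∉₁) (±root-∉ₑ s₂ e₂ ∉₂) (±root-∈ₑ s₃ e₃ ∈₃))
  ... | yes ∈₁ | yes ∈₂ | yes ∈₃ =
        contradiction (sum≡0 p)
          (unit+unit+unit≢0 (±root-∈ₑ s₁ e₁ ∈₁) (±root-∈ₑ s₂ e₂ ∈₂) (±root-∈ₑ s₃ e₃ ∈₃))

  ¬doubled-edge : ∀ {a b e₁ e₂ e₃} → (∀ p → EvenIncidence p e₁ e₂ e₃) → a ≢ b →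
                  a ∈ₑ e₁ → b ∈ₑ e₁ → a ∈ₑ e₂ → b ∈ₑ e₂ → ¬ a ∈ₑ e₃ → ¬ b ∈ₑ e₃ → ⊥
  ¬doubled-edge {a} {b} {e₁} {e₂} {e₃} inc a≢b a∈₁ b∈₁ a∈₂ b∈₂ a∉₃ b∉₃ = case inc (lo e₃) of λ where
      (∈∉∈ c∈₁ _ _) → ∈ₑ-pigeonhole e₁ a≢b b≢c a≢c a∈₁ b∈₁ c∈₁
      (∉∈∈ _ c∈₂ _) → ∈ₑ-pigeonhole e₂ a≢b b≢c a≢c a∈₂ b∈₂ c∈₂
      (∉∉∉ _ _ c∉₃) → c∉₃ (inj₁ refl)
      (∈∈∉ _ _ c∉₃) → c∉₃ (inj₁ refl)
    where
    a≢c : a ≢ lo e₃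
    a≢c = ∉ₑ-∈ₑ⇒≢ e₃ a∉₃ (inj₁ refl)

    b≢c : b ≢ lo e₃
    b≢c = ∉ₑ-∈ₑ⇒≢ e₃ b∉₃ (inj₁ refl)

  -- For e₁ = {a, b} with a ∈ e₂: b ∉ e₂, since otherwise the vertices of e₃ could lie on no
  -- other edge; so b ∈ e₃, and the other vertex c of e₂ must lie on e₃, giving the triangle abc.
  EvenIncidence⇒RK-lo∈₂ : ∀ {e₁ e₂ e₃} → (∀ p → EvenIncidence p e₁ e₂ e₃) →
                          lo e₁ ∈ₑ e₂ → ¬ lo e₁ ∈ₑ e₃ → RK e₁ e₂ e₃
  EvenIncidence⇒RK-lo∈₂ {e₁} {e₂} inc a∈₂ a∉₃ with inc (hi e₁)
  ... | ∉∉∉ b∉₁ _ _ = contradiction (inj₂ refl) b∉₁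
  ... | ∉∈∈ b∉₁ _ _ = contradiction (inj₂ refl) b∉₁
  ... | ∈∈∉ _ b∈₂ b∉₃ =
        ⊥-elim (¬doubled-edge inc (edge-lo≢hi e₁) (inj₁ refl) (inj₂ refl) a∈₂ b∈₂ a∉₃ b∉₃)
  ... | ∈∉∈ _ b∉₂ b∈₃ with other-endpoint e₂ a∈₂
  ...   | c , c∈₂ , c≢a with inc c
  ...     | ∉∈∈ _ _ c∈₃ =
            triangle (edge-lo≢hi e₁ ∘ sym) (c≢a ∘ sym) (∉ₑ-∈ₑ⇒≢ e₂ b∉₂ c∈₂)
                     (inj₂ refl) (inj₁ refl) a∈₂ c∈₂ b∈₃ c∈₃
  ...     | ∈∈∉ c∈₁ _ _ =
            ⊥-elim (∈ₑ-pigeonhole e₁ (edge-lo≢hi e₁) (∉ₑ-∈ₑ⇒≢ e₂ b∉₂ c∈₂) (c≢a ∘ sym)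
                                  (inj₁ refl) (inj₂ refl) c∈₁)
  ...     | ∉∉∉ _ c∉₂ _ = contradiction c∈₂ c∉₂
  ...     | ∈∉∈ _ c∉₂ _ = contradiction c∈₂ c∉₂

  EvenIncidence⇒RK : ∀ {e₁ e₂ e₃} → (∀ p → EvenIncidence p e₁ e₂ e₃) → RK e₁ e₂ e₃
  EvenIncidence⇒RK {e₁} inc with inc (lo e₁)
  ... | ∈∈∉ _ a∈₂ a∉₃ = EvenIncidence⇒RK-lo∈₂ inc a∈₂ a∉₃
  ... | ∈∉∈ _ a∉₂ a∈₃ = RK-swap₂₃ (EvenIncidence⇒RK-lo∈₂ (EvenIncidence-swap₂₃ ∘ inc) a∈₃ a∉₂)
  ... | ∉∉∉ a∉₁ _ _   = contradiction (inj₁ refl) a∉₁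
  ... | ∉∈∈ a∉₁ _ _   = contradiction (inj₁ refl) a∉₁

  RK⇒ZeroSignedSum : ∀ {e₁ e₂ e₃} → RK e₁ e₂ e₃ → ZeroSignedSum (root e₁) (root e₂) (root e₃)
  RK⇒ZeroSignedSum (a , b , c , _ , _ , _ , p) =
    ZeroSignedSum-↭ (map⁺ root (↭-sym p)) (⊕ , ⊕ , ⊖ , λ t → telescope (ε a t) (ε b t) (ε c t))
    where
    telescope : ∀ x y z → ((x ℤ.- y) ℤ.+ (y ℤ.- z)) ℤ.+ ℤ.- (x ℤ.- z) ≡ + 0
    telescope x y z =
      ≡-trans (cong (ℤ._+ ℤ.- (x ℤ.- z)) (ℤP.+-minus-telescope x y z)) (ℤP.+-inverseʳ (x ℤ.- z))

  RK⇔ZeroSignedSum : ∀ {e₁ e₂ e₃} → RK e₁ e₂ e₃ ⇔ ZeroSignedSum (root e₁) (root e₂) (root e₃)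
  RK⇔ZeroSignedSum = mk⇔ RK⇒ZeroSignedSum (EvenIncidence⇒RK ∘ ZeroSignedSum⇒EvenIncidence)

module Enumeration {n m : ℕ} {α : Fin m → Fin n → ℤ} (enum : IsEnumeration n m α) where

  α-InA : ∀ i → InA n (α i)
  α-InA = proj₁ enum

  covered : ∀ {v} → InA n v → ∃ λ i → v ≈± α i
  covered {v} v∈A = map₂ ⊎⇒≈± (proj₁ (proj₂ enum) v v∈A)

  α-injective± : ∀ {i j} → α i ≈± α j → i ≡ j
  α-injective± = proj₂ (proj₂ enum) _ _ ∘ ≈±⇒⊎

  index : Edge n → Fin m
  index e = proj₁ (covered (root-InA e))

  α-index : ∀ e → α (index e) ≈± root e
  α-index e = ≈±-sym (proj₂ (covered (root-InA e)))

  index-injective : Injective _≡_ _≡_ index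
  index-injective {e} {e′} index≡ =
    root-≈±-injective (≈±-trans (≈±-sym (α-index e))
                                (subst (λ i → α i ≈± root e′) (sym index≡) (α-index e′)))

  index-surjective : Surjective _≡_ _≡_ index
  index-surjective i with InA⇒≈±root (α-InA i)
  ... | e , αi≈root = e , λ { refl → α-injective± (≈±-trans (α-index e) (≈±-sym αi≈root)) }

  𝒯K≅𝒯Ω : Iso (𝒯K n) (𝒯Ω α)
  𝒯K≅𝒯Ω = mk⤖ (index-injective , index-surjective) , λ e₁ e₂ e₃ →
    ⇔.trans RK⇔ZeroSignedSum
            (ZeroSignedSum-cong (≈±-sym (α-index e₁)) (≈±-sym (α-index e₂)) (≈±-sym (α-index e₃)))

lemma2p3 : (n : ℕ) → 1 ≤ n →
    (m : ℕ) (α : Fin m → Fin n → ℤ) → IsEnumeration n m α →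
    Σ (Iso (𝒯K n) (𝒯Ω α)) λ φ →
      ∀ (x : Fin m → ℚ) →
        InP (𝒯Ω α) x ⇔ InP (𝒯K n) (x ∘ Bijection.to (proj₁ φ))
lemma2p3 n _ m α enum = 𝒯K≅𝒯Ω , InP-transport {𝒯K n} {𝒯Ω α} 𝒯K≅𝒯Ω
  where open Enumeration enum
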